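{- Let $S=(E,\mathcal F)$ be a proper set system and $e\in E$. The following are equivalent: (i) $e$ is a loop of $S+e$ (i.e. $e$ is a pseudo-loop of $S$); (ii) for every $F\subseteq E-e$, $F\cup e\in\mathcal F$ if and only if $F\in\mathcal F$; (iii) $S*e=S$. Moreover, pseudo-loops of $S$ are neither loops nor coloops of $S$, and $S\ddagger e=S\setminus e=S/e$ if and only if $e$ is a loop, a coloop, or a pseudo-loop of $S$.
   Context: A set system is a pair $S=(E,\mathcal F)$ where $E$ is a finite set and $\mathcal F$ is a collection of subsets of $E$ (the feasible sets); $S$ is proper if $\mathcal F\neq\emptyset$. For $e\in E$: $e$ is a loop if it lies in no feasible set, and a coloop if it lies in every feasible set. If $e$ is not a loop, $S/e=(E-e,\{F-e: e\in F\in\mathcal F\})$; if $e$ is not a coloop, $S\setminus e=(E-e,\{F\in\mathcal F: e\notin F\})$; if $e$ is a loop or a coloop, whichever of $S/e$, $S\setminus e$ is undefined is set equal to the other. For $A\subseteq E$, the twist is $S*A=(E,\{F\triangle A: F\in\mathcal F\})$ (write $S*e$ for $S*\{e\}$), and the loop complementation $S+A$ is the set system on $E$ in which $F\subseteq E$ is feasible if and only if $S$ has an odd number of feasible sets $F'$ with $F-A\subseteq F'\subseteq F$ (write $S+e$ for $S+\{e\}$). The Penrose contraction is $S\ddagger e=(S+e)/e$. An element $e$ is a pseudo-loop of $S$ if $e$ is a loop of $S+e$. -}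

module Defs where

open import Data.Bool using (Bool; true; false; _∧_; _∨_; not; _xor_; if_then_else_)
open import Data.Nat using (ℕ; zero; suc; _%_; _≡ᵇ_)
open import Data.Fin using (Fin)
open import Data.Fin.Subset using (Subset; inside; outside; _∈_; _∉_)
open import Data.Vec using (Vec; []; _∷_; lookup; zipWith; insertAt)
open import Data.List using (List; []; _∷_; _++_; map; filterᵇ; length)
open import Data.Bool.ListAction using (any; all)
open import Relation.Binary.PropositionalEquality using (_≡_)

-- A set system on the ground set E = Fin n.  A set system is identified
-- with the characteristic (Boolean) function of its collection of feasible
-- sets: F is feasible iff S F ≡ true.
SetSystem : ℕ → Set
SetSystem n = Subset n → Bool

_∈𝓕_ : ∀ {n} → Subset n → SetSystem n → Set
F ∈𝓕 S = S F ≡ true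

_≈_ : ∀ {n} → SetSystem n → SetSystem n → Set
S ≈ T = ∀ F → S F ≡ T F

infix 4 _≈_

Proper : ∀ {n} → SetSystem n → Set
Proper {n} S = Data.Product.Σ (Subset n) (λ F → F ∈𝓕 S)
  where import Data.Product

allSubsets : ∀ n → List (Subset n)
allSubsets zero = [] ∷ []
allSubsets (suc n) = map (outside ∷_) (allSubsets n) ++ map (inside ∷_) (allSubsets n)

_⊆ᵇ_ : ∀ {n} → Subset n → Subset n → Bool
[] ⊆ᵇ [] = true
(x ∷ xs) ⊆ᵇ (y ∷ ys) = (not x ∨ y) ∧ (xs ⊆ᵇ ys)

_∖_ : ∀ {n} → Subset n → Subset n → Subset n
_∖_ = zipWith (λ x y → x ∧ not y)

_△_ : ∀ {n} → Subset n → Subset n → Subset n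
_△_ = zipWith _xor_

IsLoop : ∀ {n} → SetSystem n → Fin n → Set
IsLoop S e = ∀ F → F ∈𝓕 S → e ∉ F

IsColoop : ∀ {n} → SetSystem n → Fin n → Set
IsColoop S e = ∀ F → F ∈𝓕 S → e ∈ F

isLoopᵇ : ∀ {n} → SetSystem n → Fin n → Bool
isLoopᵇ {n} S e = not (any (λ F → S F ∧ lookup F e) (allSubsets n))

isColoopᵇ : ∀ {n} → SetSystem n → Fin n → Bool
isColoopᵇ {n} S e = all (λ F → not (S F) ∨ lookup F e) (allSubsets n)

_*_ : ∀ {n} → SetSystem n → Subset n → SetSystem n
(S * A) F = S (F △ A)

_+_ : ∀ {n} → SetSystem n → Subset n → SetSystem n
_+_ {n} S A F =
  (length (filterᵇ (λ F' → S F' ∧ ((F ∖ A) ⊆ᵇ F') ∧ (F' ⊆ᵇ F)) (allSubsets n)) % 2) ≡ᵇ 1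

-- Minors.  A subset X of E - e (E = Fin (suc m)) corresponds to the subset
-- insertAt X e b of E, with b the membership of e.
-- deletion without convention: {F ∈ 𝓕 : e ∉ F}
del₀ : ∀ {m} → SetSystem (suc m) → Fin (suc m) → SetSystem m
del₀ S e X = S (insertAt X e outside)

con₀ : ∀ {m} → SetSystem (suc m) → Fin (suc m) → SetSystem m
con₀ S e X = S (insertAt X e inside)

_/_ : ∀ {m} → SetSystem (suc m) → Fin (suc m) → SetSystem m
S / e = if isLoopᵇ S e then del₀ S e else con₀ S e

_\\_ : ∀ {m} → SetSystem (suc m) → Fin (suc m) → SetSystem m
S \\ e = if isColoopᵇ S e then con₀ S e else del₀ S e

_‡_ : ∀ {m} → SetSystem (suc m) → Fin (suc m) → SetSystem m
S ‡ e = (S + Data.Fin.Subset.⁅ e ⁆) / e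

IsPseudoLoop : ∀ {n} → SetSystem n → Fin n → Set
IsPseudoLoop S e = IsLoop (S + Data.Fin.Subset.⁅ e ⁆) e

-- Write a = del₀ S e and b = con₀ S e for the two halves of S along e
-- (feasible sets avoiding e, and feasible sets containing e with e removed).
-- Every subset of E is insertAt X e c for a unique X ⊆ E - e and bit c, so
-- statements about S reduce to statements about the pair (a, b).
--
-- The one computation in the proof is that loop complementation at e acts on
-- this pair as (a, b) ↦ (a, a xor b): the interval [F - e, F] contains only F
-- when e ∉ F, and exactly F - e and F when e ∈ F.  Hence e is a pseudo-loop
-- iff a xor b is empty iff a = b, and conditions (ii) and (iii) are restating
-- a = b.  Loops mean b = ∅, coloops a = ∅, so for a proper S a pseudo-loop is
-- neither.  Finally S / e, S \ e and S ‡ e are each a, b or a xor b depending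
-- on which of these cases holds, and comparing them gives the last claim.
module Submission where

open import Defs
open import Data.Fin using (Fin)
open import Data.Fin.Subset using (Subset; ⁅_⁆; _∪_; _∉_)
open import Data.Nat using (ℕ; suc)
open import Data.Product using (_×_)
open import Data.Sum using (_⊎_)
open import Function.Bundles using (_⇔_)
open import Relation.Nullary using (¬_)

open import Data.Bool using (Bool; true; false; _∧_; _∨_; not; _xor_; T)
open import Data.Bool.Properties
  using (∧-identityʳ; ∧-zeroʳ; ∨-identityʳ; xor-identityʳ; xor-same; ¬-not; T-≡; T-∧)
open import Data.Bool.ListAction using (any; all)
open import Data.Fin using (zero; suc)
open import Data.Fin.Subset using (_∈_)
open import Data.List using (List; []; _∷_; _++_; map; filterᵇ; length)
open import Data.List.Membership.Propositional using (lose) renaming (_∈_ to _∈ₗ_)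
open import Data.List.Membership.Propositional.Properties using (∈-map⁺; ∈-++⁺ˡ; ∈-++⁺ʳ)
open import Data.List.Properties using (filter-++; length-++)
open import Data.List.Relation.Unary.All as All using ()
open import Data.List.Relation.Unary.All.Properties using (all⁺; all⁻)
open import Data.List.Relation.Unary.Any using (here; satisfied)
open import Data.List.Relation.Unary.Any.Properties using (any⁺; any⁻)
open import Data.Nat using (_%_; _≡ᵇ_) renaming (_+_ to _+ℕ_)
open import Data.Nat.Properties using (+-identityʳ)
open import Data.Product using (_,_; proj₁; proj₂)
open import Data.Sum using (inj₁; inj₂)
open import Data.Vec as Vec using (_∷_; lookup; zipWith; insertAt; removeAt)
open import Data.Vec.Properties
  using (insertAt-lookup; insertAt-removeAt; []=⇒lookup; lookup⇒[]=; zipWith-identityʳ)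
open import Function using (_∘_)
open import Function.Bundles using (mk⇔; Equivalence)
open import Function.Properties.Equivalence using () renaming (trans to ⇔-trans)
open import Relation.Binary.PropositionalEquality
  using (_≡_; refl; sym; trans; cong; cong₂; subst; module ≡-Reasoning)
open import Relation.Nullary using (Dec; yes; no; contradiction)
open import Relation.Nullary.Decidable using (T?)

true⇔⇒≡ : ∀ {x y : Bool} → (x ≡ true ⇔ y ≡ true) → x ≡ y
true⇔⇒≡ {false} {false} _ = refl
true⇔⇒≡ {false} {true} x⇔y = Equivalence.from x⇔y refl
true⇔⇒≡ {true} {false} x⇔y = sym (Equivalence.to x⇔y refl)
true⇔⇒≡ {true} {true} _ = refl

≡⇒true⇔ : ∀ {x y : Bool} → x ≡ y → (x ≡ true ⇔ y ≡ true)
≡⇒true⇔ x≡y = mk⇔ (trans (sym x≡y)) (trans x≡y)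

xor-false⇒≡ : ∀ x y → x xor y ≡ false → x ≡ y
xor-false⇒≡ false false _ = refl
xor-false⇒≡ true true _ = refl

∈-allSubsets : ∀ {n} (F : Subset n) → F ∈ₗ allSubsets n
∈-allSubsets Vec.[] = here refl
∈-allSubsets {suc n} (false ∷ F) = ∈-++⁺ˡ (∈-map⁺ (false ∷_) (∈-allSubsets F))
∈-allSubsets {suc n} (true ∷ F) =
  ∈-++⁺ʳ (map (false ∷_) (allSubsets n)) (∈-map⁺ (true ∷_) (∈-allSubsets F))

module LoopTests {n} (S : SetSystem n) (e : Fin n) where

  isLoopᵇ-sound : isLoopᵇ S e ≡ true → IsLoop S e
  isLoopᵇ-sound noWitness F F∈𝓕 e∈F =
    contradiction (trans (sym (cong not (Equivalence.to T-≡ witnessed))) noWitness) λ ()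
    where
    witnessed : T (any (λ G → S G ∧ lookup G e) (allSubsets n))
    witnessed = any⁺ _ (lose (∈-allSubsets F)
      (Equivalence.from T-≡ (trans (cong (_∧ lookup F e) F∈𝓕) ([]=⇒lookup e∈F))))

  isLoopᵇ-complete : IsLoop S e → isLoopᵇ S e ≡ true
  isLoopᵇ-complete loop = cong not (¬-not noWitness)
    where
    noWitness : ¬ any (λ G → S G ∧ lookup G e) (allSubsets n) ≡ true
    noWitness anyTrue with satisfied (any⁻ _ (allSubsets n) (Equivalence.from T-≡ anyTrue))
    ... | F , witness with Equivalence.to (T-∧ {S F}) witness
    ...   | F∈𝓕 , e∈F =
      loop F (Equivalence.to T-≡ F∈𝓕) (lookup⇒[]= e F (Equivalence.to T-≡ e∈F))

  isColoopᵇ-sound : isColoopᵇ S e ≡ true → IsColoop S e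
  isColoopᵇ-sound allContain F F∈𝓕 = lookup⇒[]= e F (Equivalence.to T-≡ containsE)
    where
    containsE : T (lookup F e)
    containsE = subst (λ b → T (not b ∨ lookup F e)) F∈𝓕
      (All.lookup (all⁺ _ (allSubsets n) (Equivalence.from T-≡ allContain)) (∈-allSubsets F))

  isColoopᵇ-complete : IsColoop S e → isColoopᵇ S e ≡ true
  isColoopᵇ-complete coloop =
    Equivalence.to T-≡ (all⁻ (λ F → not (S F) ∨ lookup F e) {allSubsets n}
      (All.tabulate λ {F} _ → Equivalence.from T-≡ (containsE F)))
    where
    containsE : ∀ F → not (S F) ∨ lookup F e ≡ true
    containsE F with S F in F∈𝓕
    ... | false = refl
    ... | true = []=⇒lookup (coloop F F∈𝓕)

  loop? : Dec (IsLoop S e)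
  loop? with isLoopᵇ S e in test
  ... | true = yes (isLoopᵇ-sound test)
  ... | false = no λ loop → contradiction (trans (sym test) (isLoopᵇ-complete loop)) λ ()

  coloop? : Dec (IsColoop S e)
  coloop? with isColoopᵇ S e in test
  ... | true = yes (isColoopᵇ-sound test)
  ... | false = no λ coloop → contradiction (trans (sym test) (isColoopᵇ-complete coloop)) λ ()

open LoopTests

count : ∀ {A : Set} → (A → Bool) → List A → ℕ
count p xs = length (filterᵇ p xs)

count-++ : ∀ {A : Set} (p : A → Bool) (xs ys : List A) →
  count p (xs ++ ys) ≡ count p xs +ℕ count p ys
count-++ p xs ys = trans (cong length (filter-++ (T? ∘ p) xs ys)) (length-++ (filterᵇ p xs))

count-map : ∀ {A B : Set} (p : B → Bool) (f : A → B) (xs : List A) →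
  count p (map f xs) ≡ count (p ∘ f) xs
count-map p f [] = refl
count-map p f (x ∷ xs) with p (f x)
... | true = cong suc (count-map p f xs)
... | false = count-map p f xs

count-none : ∀ {A : Set} (p : A → Bool) → (∀ x → p x ≡ false) → (xs : List A) → count p xs ≡ 0
count-none p none [] = refl
count-none p none (x ∷ xs) rewrite none x = count-none p none xs

slice : ∀ {n} → SetSystem (suc n) → Bool → SetSystem n
slice S b F = S (b ∷ F)

count-allSubsets : ∀ n (p : Subset (suc n) → Bool) →
  count p (allSubsets (suc n))
    ≡ count (λ F → p (false ∷ F)) (allSubsets n) +ℕ count (λ F → p (true ∷ F)) (allSubsets n)
count-allSubsets n p =
  trans (count-++ p (map (false ∷_) (allSubsets n)) (map (true ∷_) (allSubsets n)))
        (cong₂ _+ℕ_ (count-map p (false ∷_) (allSubsets n)) (count-map p (true ∷_) (allSubsets n)))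

inInterval : ∀ {n} → SetSystem n → Subset n → Subset n → Subset n → Bool
inInterval S L U F = S F ∧ (L ⊆ᵇ F) ∧ (F ⊆ᵇ U)

bit : Bool → ℕ
bit true = 1
bit false = 0

intervalCount : ∀ {n} → SetSystem n → Subset n → Subset n → ℕ
intervalCount S Vec.[] Vec.[] = bit (S Vec.[])
intervalCount S (false ∷ L) (false ∷ U) = intervalCount (slice S false) L U
intervalCount S (false ∷ L) (true ∷ U) =
  intervalCount (slice S false) L U +ℕ intervalCount (slice S true) L U
intervalCount S (true ∷ L) (false ∷ U) = 0
intervalCount S (true ∷ L) (true ∷ U) = intervalCount (slice S true) L U

∧∧-zeroʳ : ∀ x y → x ∧ (y ∧ false) ≡ false
∧∧-zeroʳ x y = trans (cong (x ∧_) (∧-zeroʳ y)) (∧-zeroʳ x)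

interval-count : ∀ {n} (S : SetSystem n) (L U : Subset n) →
  count (inInterval S L U) (allSubsets n) ≡ intervalCount S L U
interval-count S Vec.[] Vec.[] with S Vec.[]
... | true = refl
... | false = refl
interval-count {suc n} S (false ∷ L) (false ∷ U) =
  trans (count-allSubsets n _)
    (trans (cong₂ _+ℕ_ (interval-count (slice S false) L U)
                       (count-none _ (λ F → ∧∧-zeroʳ (S (true ∷ F)) (L ⊆ᵇ F)) (allSubsets n)))
           (+-identityʳ _))
interval-count {suc n} S (false ∷ L) (true ∷ U) =
  trans (count-allSubsets n _)
    (cong₂ _+ℕ_ (interval-count (slice S false) L U) (interval-count (slice S true) L U))
interval-count {suc n} S (true ∷ L) (false ∷ U) =
  trans (count-allSubsets n _)
    (cong₂ _+ℕ_ (count-none _ (λ F → ∧-zeroʳ (S (false ∷ F))) (allSubsets n))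
                (count-none _ (λ F → ∧∧-zeroʳ (S (true ∷ F)) (L ⊆ᵇ F)) (allSubsets n)))
interval-count {suc n} S (true ∷ L) (true ∷ U) =
  trans (count-allSubsets n _)
    (cong₂ _+ℕ_ (count-none _ (λ F → ∧-zeroʳ (S (false ∷ F))) (allSubsets n))
                (interval-count (slice S true) L U))

intervalCount-point : ∀ {n} (S : SetSystem n) (U : Subset n) → intervalCount S U U ≡ bit (S U)
intervalCount-point S Vec.[] = refl
intervalCount-point S (false ∷ U) = intervalCount-point (slice S false) U
intervalCount-point S (true ∷ U) = intervalCount-point (slice S true) U

intervalCount-edge : ∀ {m} (S : SetSystem (suc m)) (e : Fin (suc m)) (X : Subset m) (c : Bool) →
  intervalCount S (insertAt X e false) (insertAt X e c) ≡ bit (del₀ S e X) +ℕ bit (c ∧ con₀ S e X)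
intervalCount-edge S zero X false =
  trans (intervalCount-point (slice S false) X) (sym (+-identityʳ _))
intervalCount-edge S zero X true =
  cong₂ _+ℕ_ (intervalCount-point (slice S false) X) (intervalCount-point (slice S true) X)
intervalCount-edge S (suc e) (false ∷ X) c = intervalCount-edge (slice S false) e X c
intervalCount-edge S (suc e) (true ∷ X) c = intervalCount-edge (slice S true) e X c

odd : ℕ → Bool
odd k = (k % 2) ≡ᵇ 1

parity-bits : ∀ x y → odd (bit x +ℕ bit y) ≡ x xor y
parity-bits false false = refl
parity-bits false true = refl
parity-bits true false = refl
parity-bits true true = refl

insertAt-zipWith-⁅⁆ : ∀ {m} (g : Bool → Bool → Bool) → (∀ x → g x false ≡ x) →
  (e : Fin (suc m)) (X : Subset m) (c : Bool) →
  zipWith g (insertAt X e c) ⁅ e ⁆ ≡ insertAt X e (g c true)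
insertAt-zipWith-⁅⁆ g identityʳ zero X c = cong (g c true ∷_) (zipWith-identityʳ identityʳ X)
insertAt-zipWith-⁅⁆ g identityʳ (suc e) (x ∷ X) c =
  cong₂ _∷_ (identityʳ x) (insertAt-zipWith-⁅⁆ g identityʳ e X c)

module _ {m} (S : SetSystem (suc m)) (e : Fin (suc m)) where
  open ≡-Reasoning

  loopComplement-at : ∀ X c →
    (S + ⁅ e ⁆) (insertAt X e c) ≡ del₀ S e X xor (c ∧ con₀ S e X)
  loopComplement-at X c = begin
    odd (count (inInterval S (insertAt X e c ∖ ⁅ e ⁆) (insertAt X e c)) (allSubsets (suc m)))
      ≡⟨ cong odd (interval-count S (insertAt X e c ∖ ⁅ e ⁆) (insertAt X e c)) ⟩
    odd (intervalCount S (insertAt X e c ∖ ⁅ e ⁆) (insertAt X e c))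
      ≡⟨ cong (λ L → odd (intervalCount S L (insertAt X e c))) lowerEnd ⟩
    odd (intervalCount S (insertAt X e false) (insertAt X e c))
      ≡⟨ cong odd (intervalCount-edge S e X c) ⟩
    odd (bit (del₀ S e X) +ℕ bit (c ∧ con₀ S e X))
      ≡⟨ parity-bits (del₀ S e X) (c ∧ con₀ S e X) ⟩
    del₀ S e X xor (c ∧ con₀ S e X) ∎
    where
    lowerEnd : insertAt X e c ∖ ⁅ e ⁆ ≡ insertAt X e false
    lowerEnd = trans (insertAt-zipWith-⁅⁆ _ ∧-identityʳ e X c) (cong (insertAt X e) (∧-zeroʳ c))

  deletion-of-+ : del₀ (S + ⁅ e ⁆) e ≈ del₀ S e
  deletion-of-+ X = trans (loopComplement-at X false) (xor-identityʳ (del₀ S e X))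

  contraction-of-+ : ∀ X → con₀ (S + ⁅ e ⁆) e X ≡ del₀ S e X xor con₀ S e X
  contraction-of-+ X = loopComplement-at X true

module _ {m} (e : Fin (suc m)) where

  e∈insertAt : ∀ X → e ∈ insertAt X e true
  e∈insertAt X = lookup⇒[]= e (insertAt X e true) (insertAt-lookup X e true)

  e∉insertAt : ∀ X → e ∉ insertAt X e false
  e∉insertAt X e∈ = contradiction (trans (sym (insertAt-lookup X e false)) ([]=⇒lookup e∈)) λ ()

  by-insertion : (P : Subset (suc m) → Set) → (∀ X c → P (insertAt X e c)) → ∀ F → P F
  by-insertion P onInsertions F =
    subst P (insertAt-removeAt F e) (onInsertions (removeAt F e) (lookup F e))

  by-insertion-∉ : (P : Subset (suc m) → Set) → (∀ X → P (insertAt X e false)) →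
    ∀ F → e ∉ F → P F
  by-insertion-∉ P onInsertions = by-insertion (λ F → e ∉ F → P F) insertion
    where
    insertion : ∀ X c → e ∉ insertAt X e c → P (insertAt X e c)
    insertion X false _ = onInsertions X
    insertion X true e∉ = contradiction (e∈insertAt X) e∉

module _ {m} (S : SetSystem (suc m)) (e : Fin (suc m)) where

  loop⇒contraction-empty : IsLoop S e → ∀ X → con₀ S e X ≡ false
  loop⇒contraction-empty loop X = ¬-not λ feasible → loop _ feasible (e∈insertAt e X)

  contraction-empty⇒loop : (∀ X → con₀ S e X ≡ false) → IsLoop S e
  contraction-empty⇒loop empty = by-insertion e (λ F → F ∈𝓕 S → e ∉ F) noFeasible
    where
    noFeasible : ∀ X c → insertAt X e c ∈𝓕 S → e ∉ insertAt X e c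
    noFeasible X false _ e∈ = e∉insertAt e X e∈
    noFeasible X true feasible _ = contradiction (trans (sym (empty X)) feasible) λ ()

  coloop⇒deletion-empty : IsColoop S e → ∀ X → del₀ S e X ≡ false
  coloop⇒deletion-empty coloop X = ¬-not λ feasible → e∉insertAt e X (coloop _ feasible)

module _ {m} (S : SetSystem (suc m)) (e : Fin (suc m)) where

  MinorsEqual : Set
  MinorsEqual = del₀ S e ≈ con₀ S e

  pseudoLoop⇔minorsEqual : IsPseudoLoop S e ⇔ MinorsEqual
  pseudoLoop⇔minorsEqual = mk⇔ toEqual fromEqual
    where
    toEqual : IsPseudoLoop S e → MinorsEqual
    toEqual pseudo X = xor-false⇒≡ (del₀ S e X) (con₀ S e X)
      (trans (sym (contraction-of-+ S e X)) (loop⇒contraction-empty (S + ⁅ e ⁆) e pseudo X))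

    fromEqual : MinorsEqual → IsPseudoLoop S e
    fromEqual equal = contraction-empty⇒loop (S + ⁅ e ⁆) e λ X →
      trans (contraction-of-+ S e X)
            (trans (cong (del₀ S e X xor_) (sym (equal X))) (xor-same (del₀ S e X)))

  minorsEqual⇔addingE : MinorsEqual ⇔
    (∀ (F : Subset (suc m)) → e ∉ F → ((F ∪ ⁅ e ⁆) ∈𝓕 S ⇔ F ∈𝓕 S))
  minorsEqual⇔addingE = mk⇔ toAdding fromAdding
    where
    addE : ∀ X → insertAt X e false ∪ ⁅ e ⁆ ≡ insertAt X e true
    addE X = insertAt-zipWith-⁅⁆ _∨_ ∨-identityʳ e X false

    toAdding : MinorsEqual → ∀ F → e ∉ F → ((F ∪ ⁅ e ⁆) ∈𝓕 S ⇔ F ∈𝓕 S)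
    toAdding equal = by-insertion-∉ e (λ F → (F ∪ ⁅ e ⁆) ∈𝓕 S ⇔ F ∈𝓕 S) λ X →
      ≡⇒true⇔ (trans (cong S (addE X)) (sym (equal X)))

    fromAdding : (∀ F → e ∉ F → ((F ∪ ⁅ e ⁆) ∈𝓕 S ⇔ F ∈𝓕 S)) → MinorsEqual
    fromAdding adding X =
      sym (trans (sym (cong S (addE X))) (true⇔⇒≡ (adding (insertAt X e false) (e∉insertAt e X))))

  minorsEqual⇔twistInvariant : MinorsEqual ⇔ (S * ⁅ e ⁆) ≈ S
  minorsEqual⇔twistInvariant = mk⇔ toInvariant fromInvariant
    where
    twistE : ∀ X c → insertAt X e c △ ⁅ e ⁆ ≡ insertAt X e (c xor true)
    twistE = insertAt-zipWith-⁅⁆ _xor_ xor-identityʳ e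

    toInvariant : MinorsEqual → (S * ⁅ e ⁆) ≈ S
    toInvariant equal = by-insertion e (λ F → S (F △ ⁅ e ⁆) ≡ S F) twisted
      where
      twisted : ∀ X c → S (insertAt X e c △ ⁅ e ⁆) ≡ S (insertAt X e c)
      twisted X false = trans (cong S (twistE X false)) (sym (equal X))
      twisted X true = trans (cong S (twistE X true)) (equal X)

    fromInvariant : (S * ⁅ e ⁆) ≈ S → MinorsEqual
    fromInvariant invariant X = trans (sym (invariant (insertAt X e false))) (cong S (twistE X false))

  -- In a proper set system, a pseudo-loop is neither a loop nor a coloop:
  -- a feasible set splits into feasible X and X ∪ e with a = b.
  pseudoLoop⇒neither : Proper S → IsPseudoLoop S e → (¬ IsLoop S e) × (¬ IsColoop S e)
  pseudoLoop⇒neither (F , F∈𝓕) pseudo =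
    (λ loop → contradiction (trans (sym (loop⇒contraction-empty S e loop X)) (proj₁ both)) λ ())
    , (λ coloop → contradiction (trans (sym (coloop⇒deletion-empty S e coloop X)) (proj₂ both)) λ ())
    where
    equal : MinorsEqual
    equal = Equivalence.to pseudoLoop⇔minorsEqual pseudo

    X : Subset m
    X = removeAt F e

    bothFeasible : ∀ c → S (insertAt X e c) ≡ true → con₀ S e X ≡ true × del₀ S e X ≡ true
    bothFeasible false feasible = trans (sym (equal X)) feasible , feasible
    bothFeasible true feasible = feasible , trans (equal X) feasible

    both : con₀ S e X ≡ true × del₀ S e X ≡ true
    both = bothFeasible (lookup F e) (trans (cong S (insertAt-removeAt F e)) F∈𝓕)

  loop⇒¬coloop : Proper S → IsLoop S e → ¬ IsColoop S e
  loop⇒¬coloop (F , F∈𝓕) loop coloop = loop F F∈𝓕 (coloop F F∈𝓕)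

module _ {m} (S : SetSystem (suc m)) (e : Fin (suc m)) where

  /-of-loop : IsLoop S e → S / e ≈ del₀ S e
  /-of-loop loop X rewrite isLoopᵇ-complete S e loop = refl

  /-of-nonloop : ¬ IsLoop S e → S / e ≈ con₀ S e
  /-of-nonloop nonloop X rewrite ¬-not (nonloop ∘ isLoopᵇ-sound S e) = refl

  \\-of-coloop : IsColoop S e → S \\ e ≈ con₀ S e
  \\-of-coloop coloop X rewrite isColoopᵇ-complete S e coloop = refl

  \\-of-noncoloop : ¬ IsColoop S e → S \\ e ≈ del₀ S e
  \\-of-noncoloop noncoloop X rewrite ¬-not (noncoloop ∘ isColoopᵇ-sound S e) = refl

module _ {m} (S : SetSystem (suc m)) (e : Fin (suc m)) where

  ‡-of-pseudoLoop : IsPseudoLoop S e → S ‡ e ≈ del₀ S e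
  ‡-of-pseudoLoop pseudo X = trans (/-of-loop (S + ⁅ e ⁆) e pseudo X) (deletion-of-+ S e X)

  ‡-of-nonpseudoLoop : ¬ IsPseudoLoop S e → ∀ X → (S ‡ e) X ≡ del₀ S e X xor con₀ S e X
  ‡-of-nonpseudoLoop nonpseudo X =
    trans (/-of-nonloop (S + ⁅ e ⁆) e nonpseudo X) (contraction-of-+ S e X)

  -- At a loop the contraction is empty, so either way S ‡ e is the deletion.
  ‡-of-loop : IsLoop S e → S ‡ e ≈ del₀ S e
  ‡-of-loop loop X with loop? (S + ⁅ e ⁆) e
  ... | yes pseudo = ‡-of-pseudoLoop pseudo X
  ... | no nonpseudo = trans (‡-of-nonpseudoLoop nonpseudo X)
    (trans (cong (del₀ S e X xor_) (loop⇒contraction-empty S e loop X)) (xor-identityʳ _))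

  -- At a coloop of a proper set system the deletion is empty and e is not a
  -- pseudo-loop, so S ‡ e is the contraction.
  ‡-of-coloop : Proper S → IsColoop S e → S ‡ e ≈ con₀ S e
  ‡-of-coloop proper coloop X =
    trans (‡-of-nonpseudoLoop (λ pseudo → proj₂ (pseudoLoop⇒neither S e proper pseudo) coloop) X)
          (cong (_xor con₀ S e X) (coloop⇒deletion-empty S e coloop X))

  MinorsAgree : Set
  MinorsAgree = (S ‡ e) ≈ (S \\ e) × (S \\ e) ≈ (S / e)

  -- If S \\ e = S / e and e is neither a loop nor a coloop, then the
  -- deletion equals the contraction, so e is a pseudo-loop.
  minorsAgree⇒special : MinorsAgree → IsLoop S e ⊎ IsColoop S e ⊎ IsPseudoLoop S e
  minorsAgree⇒special (_ , \\≈/) with loop? S e | coloop? S e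
  ... | yes loop | _ = inj₁ loop
  ... | no _ | yes coloop = inj₂ (inj₁ coloop)
  ... | no nonloop | no noncoloop = inj₂ (inj₂ (Equivalence.from (pseudoLoop⇔minorsEqual S e) λ X →
    trans (sym (\\-of-noncoloop S e noncoloop X)) (trans (\\≈/ X) (/-of-nonloop S e nonloop X))))

  special⇒minorsAgree : Proper S → IsLoop S e ⊎ IsColoop S e ⊎ IsPseudoLoop S e → MinorsAgree
  special⇒minorsAgree proper (inj₁ loop) =
    (λ X → trans (‡-of-loop loop X) (sym (\\-of-noncoloop S e noncoloop X)))
    , (λ X → trans (\\-of-noncoloop S e noncoloop X) (sym (/-of-loop S e loop X)))
    where
    noncoloop : ¬ IsColoop S e
    noncoloop = loop⇒¬coloop S e proper loop
  special⇒minorsAgree proper (inj₂ (inj₁ coloop)) =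
    (λ X → trans (‡-of-coloop proper coloop X) (sym (\\-of-coloop S e coloop X)))
    , (λ X → trans (\\-of-coloop S e coloop X) (sym (/-of-nonloop S e nonloop X)))
    where
    nonloop : ¬ IsLoop S e
    nonloop loop = loop⇒¬coloop S e proper loop coloop
  special⇒minorsAgree proper (inj₂ (inj₂ pseudo)) =
    (λ X → trans (‡-of-pseudoLoop pseudo X) (sym (\\-of-noncoloop S e noncoloop X)))
    , (λ X → trans (\\-of-noncoloop S e noncoloop X)
                   (trans (equal X) (sym (/-of-nonloop S e nonloop X))))
    where
    nonloop : ¬ IsLoop S e
    nonloop = proj₁ (pseudoLoop⇒neither S e proper pseudo)

    noncoloop : ¬ IsColoop S e
    noncoloop = proj₂ (pseudoLoop⇒neither S e proper pseudo)

    equal : MinorsEqual S e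
    equal = Equivalence.to (pseudoLoop⇔minorsEqual S e) pseudo

lemma3p1 : ∀ {m} (S : SetSystem (suc m)) (e : Fin (suc m)) → Proper S →
    ((IsLoop (S + ⁅ e ⁆) e ⇔ (∀ (F : Subset (suc m)) → e ∉ F → ((F ∪ ⁅ e ⁆) ∈𝓕 S ⇔ F ∈𝓕 S)))
      × (IsLoop (S + ⁅ e ⁆) e ⇔ (S * ⁅ e ⁆) ≈ S))
    × (IsPseudoLoop S e → (¬ IsLoop S e) × (¬ IsColoop S e))
    × (((S ‡ e) ≈ (S \\ e) × (S \\ e) ≈ (S / e)) ⇔ (IsLoop S e ⊎ IsColoop S e ⊎ IsPseudoLoop S e))
lemma3p1 S e proper =
  ( ⇔-trans (pseudoLoop⇔minorsEqual S e) (minorsEqual⇔addingE S e)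
  , ⇔-trans (pseudoLoop⇔minorsEqual S e) (minorsEqual⇔twistInvariant S e) )
  , pseudoLoop⇒neither S e proper
  , mk⇔ (minorsAgree⇒special S e) (special⇒minorsAgree S e proper)
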